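{- For every integer $m\geq 3$, the graph $C_m[4]$ has a $\{C_4^2,C_m^2\}$-factorization, i.e. its edge set can be partitioned into two $C_4$-factors and two $C_m$-factors.
   Context: For a graph $G$ and integer $k\geq 1$, $G[k]$ denotes the graph with vertex set $V(G)\times\{0,1,\dots,k-1\}$ in which $(u,i)$ and $(w,j)$ are adjacent if and only if $uw\in E(G)$. $C_m$ is the cycle of length $m$. A $C_\ell$-factor of a graph is a spanning subgraph that is a vertex-disjoint union of $\ell$-cycles. A $\{C_4^a,C_m^b\}$-factorization is a partition of the edge set into exactly $a$ $C_4$-factors and $b$ $C_m$-factors. -}

module Defs where

open import Data.Nat using (ℕ; suc; _%_)
open import Data.Nat.DivMod using (m%n<n)
open import Data.Fin using (Fin; toℕ; fromℕ<)
open import Data.Product using (Σ; ∃; ∃-syntax; _×_; _,_; proj₁)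
open import Data.Sum using (_⊎_)
open import Relation.Binary.PropositionalEquality using (_≡_)
open import Level using (0ℓ)

Graph : Set → Set₁
Graph V = V → V → Set

next : ∀ {n} → Fin n → Fin n
next {suc n} i = fromℕ< (m%n<n (suc (toℕ i)) (suc n))

Cycle : (m : ℕ) → Graph (Fin m)
Cycle m u w = (w ≡ next u) ⊎ (u ≡ next w)

blowup : ∀ {V} → Graph V → (k : ℕ) → Graph (V × Fin k)
blowup G k x y = G (proj₁ x) (proj₁ y)

CycleEdge : ∀ {V : Set} {ℓ : ℕ} → (Fin ℓ → V) → V → V → Set
CycleEdge c x y = ∃[ i ] ((x ≡ c i × y ≡ c (next i)) ⊎ (y ≡ c i × x ≡ c (next i)))

IsCFactor : ∀ {V : Set} → (ℓ : ℕ) → Graph V → Set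
IsCFactor {V} ℓ H =
  Σ ℕ λ t → Σ (Fin t → Fin ℓ → V) λ c →
    (∀ s i s' i' → c s i ≡ c s' i' → (s ≡ s' × i ≡ i')) ×
    (∀ v → ∃[ s ] ∃[ i ] (c s i ≡ v)) ×
    (∀ x y → (H x y → ∃[ s ] CycleEdge (c s) x y) ×
             (∃[ s ] CycleEdge (c s) x y → H x y))

ColourClass : ∀ {V : Set} {n : ℕ} → Graph V → (V → V → Fin n) → Fin n → Graph V
ColourClass G col k x y = G x y × col x y ≡ k

-- {C_4^a, C_m^b}-factorization of G: a colouring of the edges by a + b colours
-- (a symmetric function on vertex pairs, relevant only on edges), where
-- colours 0..a-1 form C_4-factors and colours a..a+b-1 form C_m-factors.
-- Every edge receives exactly one colour, so the classes partition E(G).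
HasC4CmFactorization : ∀ {V : Set} → (a m b : ℕ) → Graph V → Set
HasC4CmFactorization {V} a m b G =
  Σ (V → V → Fin (a Data.Nat.+ b)) λ col →
    (∀ x y → col x y ≡ col y x) ×
    (∀ (k : Fin a) → IsCFactor 4 (ColourClass G col (k Data.Fin.↑ˡ b))) ×
    (∀ (k : Fin b) → IsCFactor m (ColourClass G col (a Data.Fin.↑ʳ k)))

module Submission where

-- Write T u i j for the colour of the edge (u , i) — (u + 1 , j), so that a colouring of C_m[4]
-- is a 4 × 4 table for every gap between consecutive layers. In an ordinary gap the two C₄-colours
-- are {0,1} × {2,3} and {2,3} × {0,1}, one 4-cycle each, and the two C_m-colours are the perfect
-- matchings i ↦ i and i ↦ σ i, σ = (01)(23). A colour that is a perfect matching in every gap is a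
-- C_m-factor as soon as the composite of its matchings around the cycle is the identity; for the
-- σ-colour that composite is σ^m, which is fine for even m. For odd m the first two gaps form a
-- window in which the σ-colour is the matching ρ = (0 2 1 3), whose square is σ, so the composite
-- becomes ρ² σ^(m−2) = σ^(m−1) = id; there the first C₄-colour consists of two 4-cycles through
-- layers 0, 1, 2. In every gap the second C₄-colour is the image of the first under ρ, so only
-- one C₄-factor has to be constructed by hand.

open import Defs
open import Data.Nat as ℕ using (ℕ; zero; suc; _+_; _≥_; s≤s; z≤n; parity)
open import Data.Parity.Base using (Parity; 0ℙ; 1ℙ)
open import Data.Nat.DivMod using (m<n⇒m%n≡m; n%n≡0)
open import Data.Nat.Properties using (m≢1+n+m)
open import Data.Fin using (Fin; zero; suc; toℕ; fromℕ; inject₁)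
open import Data.Fin.Properties
  using (_≟_; all?; any?; toℕ-injective; toℕ-fromℕ<; toℕ-inject₁; toℕ-fromℕ; toℕ<n)
open import Data.Fin.Patterns using (0F; 1F; 2F; 3F)
open import Data.Fin.Relation.Unary.Top using (view; ‵fromℕ; ‵inj₁)
open import Data.Vec using (Vec; []; _∷_; lookup)
open import Data.Product using (∃-syntax; _×_; _,_; proj₁; proj₂; uncurry)
open import Data.Sum using (_⊎_; inj₁; inj₂)
open import Data.Product.Properties using (≡-dec)
open import Relation.Binary.Definitions using (DecidableEquality)
open import Data.Empty using (⊥-elim)
open import Function using (_∘_)
open import Function.Bundles using (_↔_; Inverse; mk↔ₛ′; _⇔_; mk⇔; Equivalence)
open import Function.Properties.Inverse using (↔-refl; ↔-trans)
open import Relation.Nullary using (Dec; yes; no)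
open import Relation.Nullary.Decidable using (True; toWitness; map′; _×-dec_; _⊎-dec_; _→-dec_)
open import Relation.Binary.PropositionalEquality
open ≡-Reasoning

next-inject₁ : ∀ {k} (j : Fin k) → next (inject₁ j) ≡ suc j
next-inject₁ {k} j = toℕ-injective (begin
  toℕ (next (inject₁ j))          ≡⟨ toℕ-fromℕ< _ ⟩
  suc (toℕ (inject₁ j)) ℕ.% suc k ≡⟨ cong (λ a → suc a ℕ.% suc k) (toℕ-inject₁ j) ⟩
  suc (toℕ j) ℕ.% suc k           ≡⟨ m<n⇒m%n≡m (s≤s (toℕ<n j)) ⟩
  suc (toℕ j)                     ∎)

next-fromℕ : ∀ k → next (fromℕ k) ≡ zero
next-fromℕ k = toℕ-injective (begin
  toℕ (next (fromℕ k))          ≡⟨ toℕ-fromℕ< _ ⟩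
  suc (toℕ (fromℕ k)) ℕ.% suc k ≡⟨ cong (λ a → suc a ℕ.% suc k) (toℕ-fromℕ k) ⟩
  suc k ℕ.% suc k               ≡⟨ n%n≡0 (suc k) ⟩
  0                             ∎)

prev : ∀ {k} → Fin (suc k) → Fin (suc k)
prev {k} zero = fromℕ k
prev (suc j) = inject₁ j

next-prev : ∀ {k} (u : Fin (suc k)) → next (prev u) ≡ u
next-prev {k} zero = next-fromℕ k
next-prev (suc j) = next-inject₁ j

prev-next : ∀ {k} (u : Fin (suc k)) → prev (next u) ≡ u
prev-next {k} u with view u
... | ‵fromℕ = cong prev (next-fromℕ k)
... | ‵inj₁ {i = j} _ = cong prev (next-inject₁ j)

next²≢id : ∀ {n} (u : Fin (3 + n)) → next (next u) ≢ u
next²≢id u e = prev²≢id u (begin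
  u                            ≡⟨ prev-next u ⟨
  prev (next u)                ≡⟨ cong prev (prev-next (next u)) ⟨
  prev (prev (next (next u)))  ≡⟨ cong (prev ∘ prev) e ⟩
  prev (prev u)                ∎)
  where
  prev²≢id : ∀ {n} (u : Fin (3 + n)) → u ≢ prev (prev u)
  prev²≢id zero ()
  prev²≢id (suc zero) ()
  prev²≢id (suc (suc j)) e = m≢1+n+m (toℕ j) {1} (sym (begin
    suc (suc (toℕ j))          ≡⟨ cong toℕ e ⟩
    toℕ (inject₁ (inject₁ j))  ≡⟨ toℕ-inject₁ (inject₁ j) ⟩
    toℕ (inject₁ j)            ≡⟨ toℕ-inject₁ j ⟩
    toℕ j                      ∎))

CycleEdge-sym : ∀ {V : Set} {ℓ} (c : Fin ℓ → V) {x y} → CycleEdge c x y → CycleEdge c y x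
CycleEdge-sym c (p , inj₁ e) = p , inj₂ e
CycleEdge-sym c (p , inj₂ e) = p , inj₁ e

CycleEdge-map : ∀ {V W : Set} {ℓ} (f : V → W) (c : Fin ℓ → V) {x y}
  → CycleEdge c x y → CycleEdge (f ∘ c) (f x) (f y)
CycleEdge-map f c (p , inj₁ (ex , ey)) = p , inj₁ (cong f ex , cong f ey)
CycleEdge-map f c (p , inj₂ (ey , ex)) = p , inj₂ (cong f ey , cong f ex)

module GapColouring {n k c : ℕ} (T : Fin (3 + n) → Fin k → Fin k → Fin (suc c)) where

  V : Set
  V = Fin (3 + n) × Fin k

  G : Graph V
  G = blowup (Cycle (3 + n)) k

  -- Pairs of vertices that are not adjacent get the junk colour zero.
  colour : V → V → Fin (suc c)
  colour (u , i) (w , j) with w ≟ next u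
  ... | yes _ = T u i j
  ... | no _ with u ≟ next w
  ...   | yes _ = T w j i
  ...   | no _ = zero

  colour-forward : ∀ {u w} i j → w ≡ next u → colour (u , i) (w , j) ≡ T u i j
  colour-forward {u} i j refl with next u ≟ next u
  ... | yes _ = refl
  ... | no ne = ⊥-elim (ne refl)

  colour-backward : ∀ {u w} i j → u ≡ next w → colour (u , i) (w , j) ≡ T w j i
  colour-backward {w = w} i j refl with w ≟ next (next w)
  ... | yes e = ⊥-elim (next²≢id w (sym e))
  ... | no _ with next w ≟ next w
  ...   | yes _ = refl
  ...   | no ne = ⊥-elim (ne refl)

  colour-apart : ∀ {u w} i j → w ≢ next u → u ≢ next w → colour (u , i) (w , j) ≡ zero
  colour-apart {u} {w} i j w≢ u≢ with w ≟ next u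
  ... | yes e = ⊥-elim (w≢ e)
  ... | no _ with u ≟ next w
  ...   | yes e = ⊥-elim (u≢ e)
  ...   | no _ = refl

  colour-sym : ∀ x y → colour x y ≡ colour y x
  colour-sym (u , i) (w , j) = by-adjacency (w ≟ next u) (u ≟ next w)
    where
    by-adjacency : Dec (w ≡ next u) → Dec (u ≡ next w)
      → colour (u , i) (w , j) ≡ colour (w , j) (u , i)
    by-adjacency (yes e) _ = trans (colour-forward i j e) (sym (colour-backward j i e))
    by-adjacency (no _) (yes e) = trans (colour-backward i j e) (sym (colour-forward j i e))
    by-adjacency (no w≢) (no u≢) = trans (colour-apart i j w≢ u≢) (sym (colour-apart j i u≢ w≢))

  GapEdge : Fin (suc c) → V → V → Set
  GapEdge κ (u , i) (w , j) = w ≡ next u × T u i j ≡ κ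

  Joined : Fin (suc c) → V → V → Set
  Joined κ x y = GapEdge κ x y ⊎ GapEdge κ y x

  Joined⇔ColourClass : ∀ κ x y → Joined κ x y ⇔ ColourClass G colour κ x y
  Joined⇔ColourClass κ (u , i) (w , j) = mk⇔ to from
    where
    to : Joined κ (u , i) (w , j) → ColourClass G colour κ (u , i) (w , j)
    to (inj₁ (e , t)) = inj₁ e , trans (colour-forward i j e) t
    to (inj₂ (e , t)) = inj₂ e , trans (colour-backward i j e) t
    from : ColourClass G colour κ (u , i) (w , j) → Joined κ (u , i) (w , j)
    from (inj₁ e , t) = inj₁ (e , trans (sym (colour-forward i j e)) t)
    from (inj₂ e , t) = inj₂ (e , trans (sym (colour-backward i j e)) t)

  record CycleSystem (ℓ : ℕ) (κ : Fin (suc c)) : Set where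
    field
      count : ℕ
      cycles : (Fin count × Fin ℓ) ↔ V

    cycle : Fin count → Fin ℓ → V
    cycle s p = Inverse.to cycles (s , p)

    field
      covers-colour : ∀ u i j → T u i j ≡ κ → ∃[ s ] CycleEdge (cycle s) (u , i) (next u , j)
      coloured : ∀ s p → Joined κ (cycle s p) (cycle s (next p))

  cycleFactor : ∀ {ℓ κ} → CycleSystem ℓ κ → IsCFactor ℓ (ColourClass G colour κ)
  cycleFactor {ℓ} {κ} S =
    count , cycle , injective , surjective , λ x y → edges→cycles x y , cycles→edges x y
    where
    open CycleSystem S
    open Inverse cycles using (from; strictlyInverseˡ; strictlyInverseʳ)
    injective : ∀ s p s' p' → cycle s p ≡ cycle s' p' → s ≡ s' × p ≡ p'
    injective s p s' p' e
      with trans (sym (strictlyInverseʳ (s , p))) (trans (cong from e) (strictlyInverseʳ (s' , p')))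
    ... | refl = refl , refl
    surjective : ∀ v → ∃[ s ] ∃[ p ] (cycle s p ≡ v)
    surjective v = proj₁ (from v) , proj₂ (from v) , strictlyInverseˡ v
    edges→cycles : ∀ x y → ColourClass G colour κ x y → ∃[ s ] CycleEdge (cycle s) x y
    edges→cycles x y xy with Equivalence.from (Joined⇔ColourClass κ x y) xy
    ... | inj₁ (refl , t) = covers-colour _ _ _ t
    ... | inj₂ (refl , t) with covers-colour _ _ _ t
    ...   | s , e = s , CycleEdge-sym (cycle s) e
    joined→class : ∀ {x y} → Joined κ x y → ColourClass G colour κ x y
    joined→class = Equivalence.to (Joined⇔ColourClass κ _ _)
    cycles→edges : ∀ x y → ∃[ s ] CycleEdge (cycle s) x y → ColourClass G colour κ x y
    cycles→edges x y (s , p , inj₁ (refl , refl)) = joined→class (coloured s p)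
    cycles→edges x y (s , p , inj₂ (refl , refl)) with coloured s p
    ... | inj₁ e = joined→class (inj₂ e)
    ... | inj₂ e = joined→class (inj₁ e)

  -- The t-th cycle meets layer u in label d u t; d exists iff the matchings compose to the identity.
  matchingSystem : ∀ {κ} (π : Fin (3 + n) → Fin k → Fin k) (d : Fin (3 + n) → Fin k ↔ Fin k)
    → (∀ u i j → T u i j ≡ κ ⇔ j ≡ π u i)
    → (∀ u t → Inverse.to (d (next u)) t ≡ π u (Inverse.to (d u) t))
    → CycleSystem (3 + n) κ
  matchingSystem {κ} π d matching trivialises = record
    { count = k
    ; cycles = mk↔ₛ′ (λ (t , u) → u , to (d u) t) (λ (u , i) → from (d u) i , u)
                     (λ (u , i) → cong (u ,_) (strictlyInverseˡ (d u) i))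
                     (λ (t , u) → cong (_, u) (strictlyInverseʳ (d u) t))
    ; covers-colour = covers
    ; coloured = λ t u → inj₁ (refl , coloured t u)
    }
    where
    open Inverse
    strand : Fin k → Fin (3 + n) → V
    strand t u = u , to (d u) t
    covers : ∀ u i j → T u i j ≡ κ → ∃[ t ] CycleEdge (strand t) (u , i) (next u , j)
    covers u i j e = t , u , inj₁ (cong (u ,_) (sym (strictlyInverseˡ (d u) i)) , cong (next u ,_) j≡)
      where
      t : Fin k
      t = from (d u) i
      j≡ : j ≡ to (d (next u)) t
      j≡ = begin
        j                   ≡⟨ Equivalence.to (matching u i j) e ⟩
        π u i               ≡⟨ cong (π u) (strictlyInverseˡ (d u) i) ⟨
        π u (to (d u) t)    ≡⟨ trivialises u t ⟨
        to (d (next u)) t   ∎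
    coloured : ∀ t u → T u (to (d u) t) (to (d (next u)) t) ≡ κ
    coloured t u = subst (λ j → T u (to (d u) t) j ≡ κ) (sym (trivialises u t))
                         (Equivalence.from (matching u _ _) refl)

  relabel : ∀ {ℓ κ κ'} (ρ : Fin k ↔ Fin k)
    → (∀ u i j → T u (Inverse.to ρ i) (Inverse.to ρ j) ≡ κ' ⇔ T u i j ≡ κ)
    → CycleSystem ℓ κ → CycleSystem ℓ κ'
  relabel {ℓ} {κ} {κ'} ρ equivariant S = record
    { count = count
    ; cycles = ↔-trans cycles ρ̂
    ; covers-colour = covers
    ; coloured = λ s p → transport (coloured s p)
    }
    where
    open CycleSystem S
    open Inverse ρ
    ρ̂ : V ↔ V
    ρ̂ = mk↔ₛ′ (λ (u , i) → u , to i) (λ (u , i) → u , from i)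
              (λ (u , i) → cong (u ,_) (strictlyInverseˡ i))
              (λ (u , i) → cong (u ,_) (strictlyInverseʳ i))
    transport-gap : ∀ {x y} → GapEdge κ x y → GapEdge κ' (Inverse.to ρ̂ x) (Inverse.to ρ̂ y)
    transport-gap (e , t) = e , Equivalence.from (equivariant _ _ _) t
    transport : ∀ {x y} → Joined κ x y → Joined κ' (Inverse.to ρ̂ x) (Inverse.to ρ̂ y)
    transport (inj₁ e) = inj₁ (transport-gap e)
    transport (inj₂ e) = inj₂ (transport-gap e)
    pull-back : ∀ {u} i j → T u i j ≡ κ' → T u (to (from i)) (to (from j)) ≡ κ'
    pull-back {u} i j = subst₂ (λ a b → T u a b ≡ κ') (sym (strictlyInverseˡ i)) (sym (strictlyInverseˡ j))
    covers : ∀ u i j → T u i j ≡ κ' → ∃[ s ] CycleEdge (Inverse.to ρ̂ ∘ cycle s) (u , i) (next u , j)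
    covers u i j e with covers-colour u (from i) (from j) (Equivalence.to (equivariant u _ _) (pull-back i j e))
    ... | s , edge = s , subst₂ (CycleEdge (Inverse.to ρ̂ ∘ cycle s))
                                (cong (u ,_) (strictlyInverseˡ i)) (cong (next u ,_) (strictlyInverseˡ j))
                                (CycleEdge-map (Inverse.to ρ̂) (cycle s) edge)

_⇔?_ : ∀ {A B : Set} → Dec A → Dec B → Dec (A ⇔ B)
a? ⇔? b? = map′ (λ (f , g) → mk⇔ f g) (λ e → Equivalence.to e , Equivalence.from e)
                ((a? →-dec b?) ×-dec (b? →-dec a?))

exhaustive₁ : ∀ {k} {P : Fin k → Set} (P? : ∀ i → Dec (P i)) → {True (all? P?)} → ∀ i → P i
exhaustive₁ _ {ok} = toWitness ok

exhaustive₂ : ∀ {k} {P : Fin k → Fin k → Set} (P? : ∀ i j → Dec (P i j))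
  → {True (all? λ i → all? (P? i))} → ∀ i j → P i j
exhaustive₂ _ {ok} = toWitness ok

pattern c4₁ = 0F
pattern c4₂ = 1F
pattern cm₁ = 2F
pattern cm₂ = 3F

σ ρ ρ⁻¹ : Fin 4 → Fin 4
σ = lookup (1F ∷ 0F ∷ 3F ∷ 2F ∷ [])
ρ = lookup (2F ∷ 3F ∷ 1F ∷ 0F ∷ [])
ρ⁻¹ = lookup (3F ∷ 2F ∷ 0F ∷ 1F ∷ [])

σ-involutive : ∀ i → σ (σ i) ≡ i
σ-involutive = exhaustive₁ (λ i → σ (σ i) ≟ i)

ρ²≡σ : ∀ i → ρ (ρ i) ≡ σ i
ρ²≡σ = exhaustive₁ (λ i → ρ (ρ i) ≟ σ i)

ρ↔ : Fin 4 ↔ Fin 4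
ρ↔ = mk↔ₛ′ ρ ρ⁻¹ (exhaustive₁ λ i → ρ (ρ⁻¹ i) ≟ i) (exhaustive₁ λ i → ρ⁻¹ (ρ i) ≟ i)

Table : Set
Table = Fin 4 → Fin 4 → Fin 4

-- Row i, column j: the colour of the edge from label i on a layer to label j on the next one.
matrix : Vec (Vec (Fin 4) 4) 4 → Table
matrix rows i j = lookup (lookup rows i) j

record Gap : Set where
  field
    table : Table
    twist : Fin 4 → Fin 4
    c4₂-is-ρ-image : ∀ i j → table (ρ i) (ρ j) ≡ c4₂ ⇔ table i j ≡ c4₁
    cm₁-is-straight : ∀ i j → table i j ≡ cm₁ ⇔ j ≡ i
    cm₂-is-twist : ∀ i j → table i j ≡ cm₂ ⇔ j ≡ twist i

checkedGap : (table : Table) (twist : Fin 4 → Fin 4)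
  → {True (all? λ i → all? λ j → (table (ρ i) (ρ j) ≟ c4₂) ⇔? (table i j ≟ c4₁))}
  → {True (all? λ i → all? λ j → (table i j ≟ cm₁) ⇔? (j ≟ i))}
  → {True (all? λ i → all? λ j → (table i j ≟ cm₂) ⇔? (j ≟ twist i))}
  → Gap
checkedGap table twist {ρ-image} {straight} {twisted} = record
  { table = table ; twist = twist
  ; c4₂-is-ρ-image = toWitness ρ-image
  ; cm₁-is-straight = toWitness straight
  ; cm₂-is-twist = toWitness twisted
  }

ordinary : Gap
ordinary = checkedGap (matrix ((cm₁ ∷ cm₂ ∷ c4₁ ∷ c4₁ ∷ [])
                             ∷ (cm₂ ∷ cm₁ ∷ c4₁ ∷ c4₁ ∷ [])
                             ∷ (c4₂ ∷ c4₂ ∷ cm₁ ∷ cm₂ ∷ [])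
                             ∷ (c4₂ ∷ c4₂ ∷ cm₂ ∷ cm₁ ∷ []) ∷ [])) σ

window₀ : Gap
window₀ = checkedGap (matrix ((cm₁ ∷ c4₁ ∷ cm₂ ∷ c4₁ ∷ [])
                            ∷ (c4₁ ∷ cm₁ ∷ c4₁ ∷ cm₂ ∷ [])
                            ∷ (c4₂ ∷ cm₂ ∷ cm₁ ∷ c4₂ ∷ [])
                            ∷ (cm₂ ∷ c4₂ ∷ c4₂ ∷ cm₁ ∷ []) ∷ [])) ρ

window₁ : Gap
window₁ = checkedGap (matrix ((cm₁ ∷ c4₂ ∷ cm₂ ∷ c4₁ ∷ [])
                            ∷ (c4₂ ∷ cm₁ ∷ c4₁ ∷ cm₂ ∷ [])
                            ∷ (c4₂ ∷ cm₂ ∷ cm₁ ∷ c4₁ ∷ [])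
                            ∷ (cm₂ ∷ c4₂ ∷ c4₁ ∷ cm₁ ∷ []) ∷ [])) ρ

square : ∀ {k} → Fin (suc k) → Fin 4 → Fin (suc k) × Fin 4
square s 0F = s , 0F
square s 1F = next s , 2F
square s 2F = s , 1F
square s 3F = next s , 3F

squareIndex : ∀ {k} → Fin (suc k) × Fin 4 → Fin (suc k) × Fin 4
squareIndex (u , 0F) = u , 0F
squareIndex (u , 1F) = u , 2F
squareIndex (u , 2F) = prev u , 1F
squareIndex (u , 3F) = prev u , 3F

squares : ∀ {k} → (Fin (suc k) × Fin 4) ↔ (Fin (suc k) × Fin 4)
squares = mk↔ₛ′ (uncurry square) squareIndex square∘index index∘square
  where
  square∘index : ∀ v → uncurry square (squareIndex v) ≡ v
  square∘index (u , 0F) = refl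
  square∘index (u , 1F) = refl
  square∘index (u , 2F) = cong (_, 2F) (next-prev u)
  square∘index (u , 3F) = cong (_, 3F) (next-prev u)
  index∘square : ∀ v → squareIndex (uncurry square v) ≡ v
  index∘square (s , 0F) = refl
  index∘square (s , 1F) = cong (_, 1F) (prev-next s)
  index∘square (s , 2F) = refl
  index∘square (s , 3F) = cong (_, 3F) (prev-next s)

square-covers : ∀ {k} (s : Fin (suc k)) i j
  → Gap.table ordinary i j ≡ c4₁ → CycleEdge (square s) (s , i) (next s , j)
square-covers s 0F 2F _ = 0F , inj₁ (refl , refl)
square-covers s 1F 2F _ = 1F , inj₂ (refl , refl)
square-covers s 1F 3F _ = 2F , inj₁ (refl , refl)
square-covers s 0F 3F _ = 3F , inj₂ (refl , refl)
square-covers s 0F 0F ()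
square-covers s 0F 1F ()
square-covers s 1F 0F ()
square-covers s 1F 1F ()
square-covers s 2F 0F ()
square-covers s 2F 1F ()
square-covers s 2F 2F ()
square-covers s 2F 3F ()
square-covers s 3F 0F ()
square-covers s 3F 1F ()
square-covers s 3F 2F ()
square-covers s 3F 3F ()

σ^ : Parity → Fin 4 ↔ Fin 4
σ^ 0ℙ = ↔-refl
σ^ 1ℙ = mk↔ₛ′ σ σ σ-involutive σ-involutive

σ^-suc : ∀ a t → Inverse.to (σ^ (parity (suc a))) t ≡ σ (Inverse.to (σ^ (parity a)) t)
σ^-suc 0 t = refl
σ^-suc 1 t = sym (σ-involutive t)
σ^-suc (suc (suc a)) t = σ^-suc a t

σ^-alternates : ∀ {k} → parity (suc k) ≡ 0ℙ → ∀ (u : Fin (suc k)) t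
  → Inverse.to (σ^ (parity (toℕ (next u)))) t ≡ σ (Inverse.to (σ^ (parity (toℕ u))) t)
σ^-alternates {k} even u t with view u
... | ‵fromℕ rewrite next-fromℕ k | toℕ-fromℕ k = begin
  t                                           ≡⟨ cong (λ p → Inverse.to (σ^ p) t) even ⟨
  Inverse.to (σ^ (parity (suc k))) t          ≡⟨ σ^-suc k t ⟩
  σ (Inverse.to (σ^ (parity k)) t)            ∎
... | ‵inj₁ {i = j} _ rewrite next-inject₁ j | toℕ-inject₁ j = σ^-suc (toℕ j) t

module GapLayout {n : ℕ} (gap : Fin (3 + n) → Gap) where

  open GapColouring (λ u → Gap.table (gap u)) public

  factorisation : CycleSystem 4 c4₁
    → (d : Fin (3 + n) → Fin 4 ↔ Fin 4)
    → (∀ u t → Inverse.to (d (next u)) t ≡ Gap.twist (gap u) (Inverse.to (d u) t))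
    → HasC4CmFactorization 2 (3 + n) 2 G
  factorisation A d trivialises =
    colour , colour-sym ,
    (λ { 0F → cycleFactor A ; 1F → cycleFactor B }) ,
    (λ { 0F → cycleFactor C ; 1F → cycleFactor D })
    where
    B : CycleSystem 4 c4₂
    B = relabel ρ↔ (λ u → Gap.c4₂-is-ρ-image (gap u)) A
    C : CycleSystem (3 + n) cm₁
    C = matchingSystem (λ _ i → i) (λ _ → ↔-refl) (λ u → Gap.cm₁-is-straight (gap u)) (λ _ _ → refl)
    D : CycleSystem (3 + n) cm₂
    D = matchingSystem (λ u → Gap.twist (gap u)) d (λ u → Gap.cm₂-is-twist (gap u)) trivialises

  square-coloured : ∀ s → gap s ≡ ordinary → ∀ p → Joined c4₁ (square s p) (square s (next p))
  square-coloured s ordinary-at-s 0F = inj₁ (refl , cong (λ g → Gap.table g 0F 2F) ordinary-at-s)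
  square-coloured s ordinary-at-s 1F = inj₂ (refl , cong (λ g → Gap.table g 1F 2F) ordinary-at-s)
  square-coloured s ordinary-at-s 2F = inj₁ (refl , cong (λ g → Gap.table g 1F 3F) ordinary-at-s)
  square-coloured s ordinary-at-s 3F = inj₂ (refl , cong (λ g → Gap.table g 0F 3F) ordinary-at-s)

even-factorisation : ∀ n → parity (3 + n) ≡ 0ℙ
  → HasC4CmFactorization 2 (3 + n) 2 (blowup (Cycle (3 + n)) 4)
even-factorisation n even = factorisation squareCycles (λ u → σ^ (parity (toℕ u))) (σ^-alternates even)
  where
  open GapLayout {n} (λ _ → ordinary)
  squareCycles : CycleSystem 4 c4₁
  squareCycles = record
    { count = 3 + n
    ; cycles = squares
    ; covers-colour = λ u i j e → u , square-covers u i j e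
    ; coloured = λ s → square-coloured s refl
    }

cycleEdge? : ∀ {V : Set} {ℓ} → DecidableEquality V → (c : Fin ℓ → V) → ∀ x y
  → Dec (CycleEdge c x y)
cycleEdge? _≟V_ c x y =
  any? λ p → ((x ≟V c p) ×-dec (y ≟V c (next p))) ⊎-dec ((y ≟V c p) ×-dec (x ≟V c (next p)))

-- The two window cycles use exactly the vertices of square 0F and square 1F.
windowed : ∀ {n} → Fin (3 + n) → Fin 4 → Fin (3 + n) × Fin 4
windowed 0F = lookup ((0F , 0F) ∷ (1F , 1F) ∷ (2F , 2F) ∷ (1F , 3F) ∷ [])
windowed 1F = lookup ((0F , 1F) ∷ (1F , 0F) ∷ (2F , 3F) ∷ (1F , 2F) ∷ [])
windowed s@(suc (suc _)) = square s

windowIndex : ∀ {n} → Fin (3 + n) × Fin 4 → Fin (3 + n) × Fin 4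
windowIndex (0F , 0F) = 0F , 0F
windowIndex (0F , 1F) = 1F , 0F
windowIndex (1F , 0F) = 1F , 1F
windowIndex (1F , 1F) = 0F , 1F
windowIndex (1F , 2F) = 1F , 3F
windowIndex (1F , 3F) = 0F , 3F
windowIndex (2F , 2F) = 0F , 2F
windowIndex (2F , 3F) = 1F , 2F
windowIndex v = squareIndex v

windows : ∀ {n} → (Fin (3 + n) × Fin 4) ↔ (Fin (3 + n) × Fin 4)
windows {n} = mk↔ₛ′ (uncurry windowed) windowIndex windowed∘index index∘windowed
  where
  open Inverse (squares {2 + n}) using (strictlyInverseˡ)
  windowed∘index : ∀ v → uncurry windowed (windowIndex v) ≡ v
  windowed∘index (0F , 0F) = refl
  windowed∘index (0F , 1F) = refl
  windowed∘index (0F , 2F) = strictlyInverseˡ _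
  windowed∘index (0F , 3F) = strictlyInverseˡ _
  windowed∘index (1F , 0F) = refl
  windowed∘index (1F , 1F) = refl
  windowed∘index (1F , 2F) = refl
  windowed∘index (1F , 3F) = refl
  windowed∘index (2F , 0F) = refl
  windowed∘index (2F , 1F) = refl
  windowed∘index (2F , 2F) = refl
  windowed∘index (2F , 3F) = refl
  windowed∘index (suc (suc (suc u)) , 0F) = refl
  windowed∘index (suc (suc (suc u)) , 1F) = refl
  windowed∘index (suc (suc (suc u)) , 2F) = strictlyInverseˡ _
  windowed∘index (suc (suc (suc u)) , 3F) = strictlyInverseˡ _
  index∘windowed : ∀ v → windowIndex (uncurry windowed v) ≡ v
  index∘windowed (0F , 0F) = refl
  index∘windowed (0F , 1F) = refl
  index∘windowed (0F , 2F) = refl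
  index∘windowed (0F , 3F) = refl
  index∘windowed (1F , 0F) = refl
  index∘windowed (1F , 1F) = refl
  index∘windowed (1F , 2F) = refl
  index∘windowed (1F , 3F) = refl
  index∘windowed (2F , 0F) = refl
  index∘windowed (2F , 2F) = refl
  index∘windowed (suc (suc (suc s)) , 0F) = refl
  index∘windowed (suc (suc (suc s)) , 2F) = refl
  index∘windowed (suc (suc s) , 1F) with view s
  ... | ‵fromℕ rewrite next-fromℕ (2 + n) = refl
  ... | ‵inj₁ {i = j} _ rewrite next-inject₁ (suc (suc j)) = refl
  index∘windowed (suc (suc s) , 3F) with view s
  ... | ‵fromℕ rewrite next-fromℕ (2 + n) = refl
  ... | ‵inj₁ {i = j} _ rewrite next-inject₁ (suc (suc j)) = refl

odd-factorisation : ∀ n → parity (3 + n) ≡ 1ℙ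
  → HasC4CmFactorization 2 (3 + n) 2 (blowup (Cycle (3 + n)) 4)
odd-factorisation n odd = factorisation windowCycles labels labels-follow-twist
  where
  gap : Fin (3 + n) → Gap
  gap 0F = window₀
  gap 1F = window₁
  gap (suc (suc _)) = ordinary
  open GapLayout gap
  _≟V_ : DecidableEquality V
  _≟V_ = ≡-dec _≟_ _≟_
  covers : ∀ u i j → Gap.table (gap u) i j ≡ c4₁ → ∃[ s ] CycleEdge (windowed s) (u , i) (next u , j)
  -- Decided by evaluation although n is unknown: the search stops at the two window cycles,
  -- whose vertices are closed terms.
  covers 0F = exhaustive₂ λ i j →
    (Gap.table window₀ i j ≟ c4₁) →-dec any? λ s → cycleEdge? _≟V_ (windowed s) (0F , i) (1F , j)
  covers 1F = exhaustive₂ λ i j →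
    (Gap.table window₁ i j ≟ c4₁) →-dec any? λ s → cycleEdge? _≟V_ (windowed s) (1F , i) (2F , j)
  covers u@(suc (suc _)) i j e = u , square-covers u i j e
  coloured : ∀ s p → Joined c4₁ (windowed s p) (windowed s (next p))
  coloured 0F 0F = inj₁ (refl , refl)
  coloured 0F 1F = inj₁ (refl , refl)
  coloured 0F 2F = inj₂ (refl , refl)
  coloured 0F 3F = inj₂ (refl , refl)
  coloured 1F 0F = inj₁ (refl , refl)
  coloured 1F 1F = inj₁ (refl , refl)
  coloured 1F 2F = inj₂ (refl , refl)
  coloured 1F 3F = inj₂ (refl , refl)
  coloured s@(suc (suc _)) = square-coloured s refl
  windowCycles : CycleSystem 4 c4₁
  windowCycles = record { count = 3 + n ; cycles = windows ; covers-colour = covers ; coloured = coloured }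
  labels : Fin (3 + n) → Fin 4 ↔ Fin 4
  labels 0F = ↔-refl
  labels 1F = ρ↔
  labels (suc (suc s)) = σ^ (parity (suc (toℕ s)))
  labels-follow-twist : ∀ u t
    → Inverse.to (labels (next u)) t ≡ Gap.twist (gap u) (Inverse.to (labels u) t)
  labels-follow-twist 0F t = refl
  labels-follow-twist 1F t = sym (ρ²≡σ t)
  labels-follow-twist (suc (suc s)) t with view s
  ... | ‵fromℕ rewrite next-fromℕ (2 + n) | toℕ-fromℕ n | odd = sym (σ-involutive t)
  ... | ‵inj₁ {i = j} _ rewrite next-inject₁ (suc (suc j)) | toℕ-inject₁ j = σ^-suc (suc (toℕ j)) t

lemma7 : (m : ℕ) → m ≥ 3 → HasC4CmFactorization 2 m 2 (blowup (Cycle m) 4)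
lemma7 (suc (suc (suc n))) (s≤s (s≤s (s≤s z≤n))) with parity (3 + n) in parity-m
... | 0ℙ = even-factorisation n parity-m
... | 1ℙ = odd-factorisation n parity-m
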